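{- Let $\mathbf x = x_1x_2\ldots$ be an infinite word over a finite alphabet and $n\ge1$ an integer with $r(n+1,\mathbf x) = r(n,\mathbf x)+1$. Let $j$ be the integer with $1 \le j < r(n,\mathbf x)-n+1$ and $x_j^{j+n-1} = x_{r(n,\mathbf x)-n+1}^{r(n,\mathbf x)}$. Then $x_{j+n} = x_{r(n,\mathbf x)+1}$.
   Context: With $x_i^j = x_i\cdots x_j$, $r(n,\mathbf x) = \min\{ m \ge 1 : x_i^{i+n-1} = x_{m-n+1}^{m} \text{ for some } i \text{ with } 1 \le i \le m-n\}$; the integer $j$ in the statement exists and is unique. -}

module Defs where

open import Data.Nat using (ℕ; _+_; _∸_; _≤_; _<_)
open import Data.Fin using (Fin)
open import Data.Product using (Σ; _×_)
open import Relation.Binary.PropositionalEquality using (_≡_)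

-- An infinite word over the finite alphabet Fin k.  Letters are indexed
-- from 1: x_i = x i for i ≥ 1 (the value x 0 is never used).
Word : ℕ → Set
Word k = ℕ → Fin k

FactorEq : ∀ {k} → Word k → ℕ → ℕ → ℕ → Set
FactorEq x n i l = ∀ t → t < n → x (i + t) ≡ x (l + t)

Occurs : ∀ {k} → ℕ → Word k → ℕ → Set
Occurs n x m = Σ ℕ λ i → (1 ≤ i) × (i ≤ m ∸ n) × FactorEq x n i (m ∸ n + 1)

-- IsR n x m : m = r(n, x), i.e. m is the least m ≥ 1 satisfying Occurs n x m.
IsR : ∀ {k} → ℕ → Word k → ℕ → Set
IsR n x m = (1 ≤ m) × Occurs n x m × (∀ m′ → 1 ≤ m′ → Occurs n x m′ → m ≤ m′)

module Submission where

-- Let m = r(n, x) and p = m - n + 1 for the start of the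
-- suffix x_p^m of x_1^m.  By minimality of r(n, x), the factor x_p^m occurs
-- only ONCE strictly before position p: if it started at a < b ≤ m - n, then
-- x_a^{a+n-1} = x_b^{b+n-1} would be an earlier repetition, ending at
-- b + n - 1 < m, contradicting minimality.  Now r(n+1, x) = m + 1 gives some
-- i ≤ m - n with x_i^{i+n} = x_p^{m+1}; its first n letters show that x_p^m
-- also starts at i, so i = j by uniqueness, and its last letter is
-- x_{j+n} = x_{m+1}.

open import Defs
open import Data.Nat using (ℕ; suc; _+_; _∸_; _≤_; _<_; s≤s; z≤n)
open import Data.Nat.Properties
open import Data.Product using (_,_)
open import Data.Empty using (⊥; ⊥-elim)
open import Relation.Binary using (tri<; tri≈; tri>)
open import Relation.Binary.PropositionalEquality
  using (_≡_; refl; sym; trans; cong; subst; module ≡-Reasoning)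

FactorEq-via : ∀ {k} (x : Word k) n {a b l} →
  FactorEq x n a l → FactorEq x n b l → FactorEq x n a b
FactorEq-via x n fa fb t t<n = trans (fa t t<n) (sym (fb t t<n))

FactorEq-init : ∀ {k} (x : Word k) n {i l} →
  FactorEq x (suc n) i l → FactorEq x n i l
FactorEq-init x n f t t<n = f t (m<n⇒m<1+n t<n)

FactorEq-last : ∀ {k} (x : Word k) n {i l} →
  FactorEq x (suc n) i l → x (i + n) ≡ x (l + n)
FactorEq-last x n f = f n ≤-refl

positive-difference : ∀ {m n} → 1 ≤ m ∸ n → n ≤ m
positive-difference 0<m∸n = <⇒≤ (m∸n≢0⇒n<m (λ e → <⇒≢ 0<m∸n (sym e)))

repetition-occurs : ∀ {k} (x : Word k) n {a b} → 1 ≤ a → a ≤ b →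
  FactorEq x n a (suc b) → Occurs n x (b + n)
repetition-occurs x n {a} {b} 1≤a a≤b f =
  a , 1≤a , subst (a ≤_) (sym (m+n∸n≡m b n)) a≤b , f′
  where
  start : b + n ∸ n + 1 ≡ suc b
  start = trans (cong (_+ 1) (m+n∸n≡m b n)) (+-comm b 1)

  f′ : FactorEq x n a (b + n ∸ n + 1)
  f′ t t<n = trans (f t t<n) (cong (λ s → x (s + t)) (sym start))

-- Minimality of m = r(n, x): the suffix x_{m-n+1}^m cannot start at two
-- different positions a < b in [1, m - n], since the repetition of the
-- factor at b would be an occurrence ending at b + n - 1 < m.
no-two-earlier-starts : ∀ {k} (x : Word k) n (m : ℕ) → IsR n x m →
  ∀ {a b} → 1 ≤ a → a < b → b ≤ m ∸ n →
  FactorEq x n a (m ∸ n + 1) → FactorEq x n b (m ∸ n + 1) → ⊥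
no-two-earlier-starts x n m (_ , _ , minimal) {a} {suc b} 1≤a a<1+b 1+b≤ fa fb =
  <-irrefl refl (<-≤-trans shorter (minimal (b + n) 1≤b+n occ))
  where
  a≤b : a ≤ b
  a≤b = ≤-pred a<1+b

  1≤b+n : 1 ≤ b + n
  1≤b+n = ≤-trans 1≤a (≤-trans a≤b (m≤m+n b n))

  occ : Occurs n x (b + n)
  occ = repetition-occurs x n 1≤a a≤b (FactorEq-via x n fa fb)

  shorter : b + n < m
  shorter = m≤o∸n⇒m+n≤o (suc b) (positive-difference (≤-trans (s≤s z≤n) 1+b≤)) 1+b≤

earlier-start-unique : ∀ {k} (x : Word k) n (m : ℕ) → IsR n x m →
  ∀ {i j} → 1 ≤ i → i ≤ m ∸ n → 1 ≤ j → j ≤ m ∸ n →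
  FactorEq x n i (m ∸ n + 1) → FactorEq x n j (m ∸ n + 1) → i ≡ j
earlier-start-unique x n m R {i} {j} 1≤i i≤ 1≤j j≤ fi fj with <-cmp i j
... | tri< i<j _ _ = ⊥-elim (no-two-earlier-starts x n m R 1≤i i<j j≤ fi fj)
... | tri≈ _ i≡j _ = i≡j
... | tri> _ _ j<i = ⊥-elim (no-two-earlier-starts x n m R 1≤j j<i i≤ fj fi)

suffix-end : ∀ m n → n ≤ m → m ∸ n + 1 + n ≡ suc m
suffix-end m n n≤m = begin
  m ∸ n + 1 + n   ≡⟨ +-comm (m ∸ n + 1) n ⟩
  n + (m ∸ n + 1) ≡⟨ sym (+-assoc n (m ∸ n) 1) ⟩
  n + (m ∸ n) + 1 ≡⟨ cong (_+ 1) (m+[n∸m]≡n n≤m) ⟩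
  m + 1           ≡⟨ +-comm m 1 ⟩
  suc m           ∎
  where open ≡-Reasoning

lemma5p5 : ∀ {k} (x : Word k) (n : ℕ) → 1 ≤ n → (m : ℕ) →
    IsR n x m → IsR (suc n) x (suc m) →
    (j : ℕ) → 1 ≤ j → j < m ∸ n + 1 → FactorEq x n j (m ∸ n + 1) →
    x (j + n) ≡ x (suc m)
lemma5p5 x n _ m Rn (_ , (i , 1≤i , i≤ , fi) , _) j 1≤j j< fj = begin
  x (j + n)           ≡⟨ cong (λ s → x (s + n)) (sym i≡j) ⟩
  x (i + n)           ≡⟨ FactorEq-last x n fi ⟩
  x (m ∸ n + 1 + n)   ≡⟨ cong x (suffix-end m n (positive-difference (≤-trans 1≤i i≤))) ⟩
  x (suc m)           ∎
  where
  open ≡-Reasoning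

  j≤ : j ≤ m ∸ n
  j≤ = m<1+n⇒m≤n (subst (j <_) (+-comm (m ∸ n) 1) j<)

  i≡j : i ≡ j
  i≡j = earlier-start-unique x n m Rn 1≤i i≤ 1≤j j≤ (FactorEq-init x n fi) fj
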